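{- For all integers $d\ge2$ and $n\ge1$, \[\frac{2}{(d-1)(n+4+\log n)}<\mathrm{FPP}([C_d]^n)<\frac{2}{(d-1)(n+1)}.\]
   Context: $C_d$ is the cyclic group of order $d$ acting regularly on $d$ points. For a permutation group $G$ on $d$ points, $[G]^n$ is the iterated wreath product acting on $d^n$ points: $[G]^1=G$ and $[G]^n$ consists of the permutations $(i,j)\mapsto(\pi(i),\rho_i(j))$ of $\{1,\dots,d^{n-1}\}\times\{1,\dots,d\}$ with $\pi\in[G]^{n-1}$, $\rho_i\in G$. $\mathrm{FPP}(\Gamma)$ is the proportion of elements of $\Gamma$ having at least one fixed point. $\log$ is the natural logarithm. -}

module Defs where

open import Data.Nat using (ℕ; zero; suc; _≤_; _!) renaming (_+_ to _+ℕ_; _*_ to _*ℕ_)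
open import Data.Nat.DivMod using (_mod_)

open import Data.Integer using (ℤ; +_) renaming (_*_ to _*ℤ_; _-_ to _-ℤ_)
open import Data.Fin using (Fin; toℕ)
open import Data.Fin.Properties using () renaming (_≟_ to _≟F_)
open import Data.Vec using (Vec; []; _∷_; lookup)
open import Data.Vec.Properties using (≡-dec)
open import Data.List using (List; []; _∷_; allFin; length; filter; concatMap; map)
open import Data.List.Relation.Unary.Any using (any?)
open import Data.Unit using (⊤; tt)
open import Data.Empty using (⊥)
open import Data.Product using (_×_; _,_; ∃-syntax)
open import Relation.Binary.PropositionalEquality using (_≡_)
open import Data.Rational.Unnormalised
  using (ℚᵘ; mkℚᵘ; 0ℚᵘ; 1ℚᵘ; _+_; _*_; _-_; _<_)
  renaming (_≤_ to _≤ᵘ_)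

-- Unnormalised rationals: a/b (with the convention a/0 = 0, never used
-- with b = 0 below in a meaningful way) and ℕ ↪ ℚᵘ.

frac : ℤ → ℕ → ℚᵘ
frac z zero    = 0ℚᵘ
frac z (suc m) = mkℚᵘ z m

fromℕ : ℕ → ℚᵘ
fromℕ n = mkℚᵘ (+ n) 0

-- The natural logarithm, only through the relation  q < log n  (n ≥ 1):
-- q < log n  ⇔  exp q < n, where exp q = lim_N Σ_{k<N} q^k / k!.
-- exp q < n  ⇔  ∃ ε > 0 such that eventually Σ_{k<N} q^k/k! + ε ≤ n.

pow : ℚᵘ → ℕ → ℚᵘ
pow q zero    = 1ℚᵘ
pow q (suc k) = q * pow q k

expPartial : ℚᵘ → ℕ → ℚᵘ
expPartial q zero    = 0ℚᵘ
expPartial q (suc N) = expPartial q N + (pow q N * frac (+ 1) (N !))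

_<log_ : ℚᵘ → ℕ → Set
q <log n = ∃[ ε ] ((0ℚᵘ < ε) × ∃[ M ] (∀ N → M ≤ N → (expPartial q N + ε) ≤ᵘ fromℕ n))

-- The iterated wreath product [C_d]^n acting on d^n points.  A point of level
-- suc n is  j ∷ i  with i a point of level n and j ∈ Fin d, i.e. the pair (i , j).

Pt : ℕ → ℕ → Set
Pt d n = Vec (Fin d) n

-- Tables encoding arbitrary functions  Pt d n → Fin d  (the family ρ_i).
Tab : ℕ → ℕ → Set
Tab d zero    = Fin d
Tab d (suc n) = Vec (Tab d n) d

look : ∀ {d} n → Tab d n → Pt d n → Fin d
look zero    t []      = t
look (suc n) t (x ∷ v) = look n (lookup t x) v

-- Elements: [G]^0 is trivial on one point, [G]^(n+1) = pairs (π , ρ).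
-- ([G]^1 is then the group of maps  j ↦ j + ρ mod d, i.e. C_d.)
Elem : ℕ → ℕ → Set
Elem d zero    = ⊤
Elem d (suc n) = Elem d n × Tab d n

rot : ∀ {d} → Fin d → Fin d → Fin d
rot {suc m} r j = (toℕ j +ℕ toℕ r) mod (suc m)

act : ∀ {d} n → Elem d n → Pt d n → Pt d n
act zero    _       []      = []
act (suc n) (π , t) (j ∷ i) = rot (look n t i) j ∷ act n π i

allVecs : ∀ {A : Set} → List A → (k : ℕ) → List (Vec A k)
allVecs xs zero    = [] ∷ []
allVecs xs (suc k) = concatMap (λ x → map (x ∷_) (allVecs xs k)) xs

allPts : ∀ d n → List (Pt d n)
allPts d n = allVecs (allFin d) n

allTabs : ∀ d n → List (Tab d n)
allTabs d zero    = allFin d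
allTabs d (suc n) = allVecs (allTabs d n) d

allElems : ∀ d n → List (Elem d n)
allElems d zero    = tt ∷ []
allElems d (suc n) = concatMap (λ π → map (π ,_) (allTabs d n)) (allElems d n)

hasFixedPoint? : ∀ d n (g : Elem d n) → _
hasFixedPoint? d n g = any? (λ p → ≡-dec _≟F_ (act n g p) p) (allPts d n)

FPP : ℕ → ℕ → ℚᵘ
FPP d n = frac (+ length (filter (hasFixedPoint? d n) (allElems d n)))
               (length (allElems d n))

-- "2 / ((d-1)(n+4+log n)) < x", for x : ℚᵘ:
--   x > 0  and  2/((d-1) x) - (n+4) < log n.
-- With x = a/b (a = numerator > 0, b = denominator), 1/x = b/a.

LowerBound : ℕ → ℕ → ℚᵘ → Set
LowerBound d n (mkℚᵘ (+ suc k) bm) =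
  (frac (+ 2 *ℤ + suc bm) ((d Data.Nat.∸ 1) *ℕ suc k) - fromℕ (n +ℕ 4)) <log n
LowerBound d n (mkℚᵘ _ bm) = ⊥

UpperBound : ℕ → ℕ → ℚᵘ → Set
UpperBound d n x = x < frac (+ 2) ((d Data.Nat.∸ 1) *ℕ (n +ℕ 1))

-- Weight each element of [C_d]^n by a ^ (number of fixed points) * b ^ (number of other points) and
-- sum to get W_n(a, b). A point (i, j) is fixed by (π, ρ) exactly when π fixes i and ρ_i = 0, so
-- summing over ρ gives W_(n+1)(a, b) = W_n(a^d + (d-1) b^d, d b^d). Evaluating at (0, 1) and (1, 1),
-- the number a_n of derangements and the order b_n satisfy a_(n+1) = a_n^d + (d-1) b_n^d and
-- b_(n+1) = d b_n^d, so c_n = b_n - a_n satisfies c_(n+1) = c_n G with G = (b_n^d - a_n^d)/(b_n - a_n).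
-- Two sharp bounds on G show that ζ_n = 2 b_n / ((d-1) c_n) = 2 / ((d-1) FPP) satisfies n + 1 < ζ_n
-- and ζ_(n+1) ≤ ζ_n + (n+1)/n, hence ζ_n ≤ n + 3 + H_(n-1). It remains to see exp(H_(n-1) - 1) < n
-- on partial sums of the exponential series: where the exponent is nonnegative this follows from
-- e^(x+h) (1-h) ≤ e^x, and where it lies in [-3, 0] from the alternating tail together with a
-- sum-of-squares bound on the partial sum of order 7.

module Submission where

open import Algebra.Bundles using (CommutativeMonoid)
open import Defs

module BigOperator {c ℓ} (M : CommutativeMonoid c ℓ) where

  open import Data.Fin using (Fin; zero; suc)
  open import Data.List using (List; []; _∷_; _++_; map; concatMap; allFin)
  open import Data.List.Properties using (map-tabulate)
  open import Data.Nat using (suc)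
  open import Data.Vec using (Vec; _∷_)
  open import Function using (_∘_; id)
  import Relation.Binary.PropositionalEquality as ≡

  open CommutativeMonoid M
  open import Algebra.Properties.CommutativeSemigroup commutativeSemigroup using (interchange)

  ⨁ : {A : Set} → (A → Carrier) → List A → Carrier
  ⨁ f []       = ε
  ⨁ f (x ∷ xs) = f x ∙ ⨁ f xs

  module _ {A : Set} where

    ⨁-cong : {f g : A → Carrier} (xs : List A) → (∀ x → f x ≈ g x) → ⨁ f xs ≈ ⨁ g xs
    ⨁-cong []       f≈g = refl
    ⨁-cong (x ∷ xs) f≈g = ∙-cong (f≈g x) (⨁-cong xs f≈g)

    ⨁-++ : (f : A → Carrier) (xs ys : List A) → ⨁ f (xs ++ ys) ≈ ⨁ f xs ∙ ⨁ f ys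
    ⨁-++ f []       ys = sym (identityˡ _)
    ⨁-++ f (x ∷ xs) ys = trans (∙-congˡ (⨁-++ f xs ys)) (sym (assoc _ _ _))

    ⨁-ε : (xs : List A) → ⨁ (λ _ → ε) xs ≈ ε
    ⨁-ε []       = refl
    ⨁-ε (x ∷ xs) = trans (identityˡ _) (⨁-ε xs)

    ⨁-∙ : (f g : A → Carrier) (xs : List A) → ⨁ (λ x → f x ∙ g x) xs ≈ ⨁ f xs ∙ ⨁ g xs
    ⨁-∙ f g []       = sym (identityˡ ε)
    ⨁-∙ f g (x ∷ xs) = trans (∙-congˡ (⨁-∙ f g xs)) (interchange (f x) (g x) _ _)

  module _ {A B : Set} where

    ⨁-map : (f : B → Carrier) (h : A → B) (xs : List A) → ⨁ f (map h xs) ≡.≡ ⨁ (f ∘ h) xs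
    ⨁-map f h []       = ≡.refl
    ⨁-map f h (x ∷ xs) = ≡.cong (f (h x) ∙_) (⨁-map f h xs)

    ⨁-concatMap : (f : B → Carrier) (g : A → List B) (xs : List A) →
                 ⨁ f (concatMap g xs) ≈ ⨁ (λ x → ⨁ f (g x)) xs
    ⨁-concatMap f g []       = refl
    ⨁-concatMap f g (x ∷ xs) = trans (⨁-++ f (g x) _) (∙-congˡ (⨁-concatMap f g xs))

    ⨁-swap : (f : A → B → Carrier) (xs : List A) (ys : List B) →
           ⨁ (λ x → ⨁ (f x) ys) xs ≈ ⨁ (λ y → ⨁ (λ x → f x y) xs) ys
    ⨁-swap f []       ys = sym (⨁-ε ys)
    ⨁-swap f (x ∷ xs) ys = trans (∙-congˡ (⨁-swap f xs ys)) (sym (⨁-∙ (f x) _ ys))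

  ⨁-allFin-suc : ∀ {k} (g : Fin (suc k) → Carrier) → ⨁ g (allFin (suc k)) ≡.≡ g zero ∙ ⨁ (g ∘ suc) (allFin k)
  ⨁-allFin-suc {k} g = ≡.cong (g zero ∙_) (≡.trans (≡.cong (⨁ g) (≡.sym (map-tabulate id suc))) (⨁-map g suc (allFin k)))

  ⨁-allVecs-suc : ∀ {A : Set} (L : List A) k (f : Vec A (suc k) → Carrier) →
                  ⨁ f (allVecs L (suc k)) ≈ ⨁ (λ x → ⨁ (λ v → f (x ∷ v)) (allVecs L k)) L
  ⨁-allVecs-suc L k f = trans (⨁-concatMap f _ L) (⨁-cong L (λ x → reflexive (⨁-map f (x ∷_) (allVecs L k))))

module Counting where

  open import Data.Bool using (true; false; if_then_else_; _∧_)
  open import Data.Bool.Properties using (if-float; if-∧; if-eta)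
  open import Data.Fin using (Fin; zero; suc; toℕ)
  open import Data.Fin.Properties using (toℕ-injective; toℕ<n; toℕ-fromℕ<) renaming (_≟_ to _≟ᶠ_)
  open import Data.List using (List; []; _∷_; allFin; length; filter; map; concatMap)
  open import Data.List.Properties using (length-tabulate)
  open import Data.List.Relation.Unary.Any using (any?)
  open import Data.Nat using (ℕ; zero; suc; _+_; _*_; _^_; _%_; _/_; _<_)
  open import Data.Nat.DivMod using (m≡m%n+[m/n]*n; m<n⇒m%n≡m)
  open import Data.Nat.GeneralisedArithmetic using (fold; iterate; iterate-is-fold)
  open import Data.Nat.Properties
  open import Data.Product using (_×_; _,_; proj₁; proj₂)
  open import Data.Vec using ([]; _∷_; lookup)
  open import Data.Vec.Properties using (≡-dec; ∷-injective)
  open import Function using (_∘_; id; mk⇔)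
  open import Relation.Binary.PropositionalEquality
  open import Relation.Nullary using (Dec; does; _×-dec_)
  open import Relation.Nullary.Decidable using (does-⇔)

  open BigOperator +-0-commutativeMonoid using () renaming
    (⨁ to ∑; ⨁-cong to ∑-cong; ⨁-∙ to ∑-+; ⨁-map to ∑-map; ⨁-concatMap to ∑-concatMap;
     ⨁-allFin-suc to ∑-allFin-suc; ⨁-allVecs-suc to ∑-allVecs-suc)
  open BigOperator *-1-commutativeMonoid using () renaming
    (⨁ to ∏; ⨁-cong to ∏-cong; ⨁-ε to ∏-1; ⨁-swap to ∏-swap; ⨁-allFin-suc to ∏-allFin-suc;
     ⨁-allVecs-suc to ∏-allVecs-suc)

  ∑-*ˡ : ∀ {A : Set} c (f : A → ℕ) xs → c * ∑ f xs ≡ ∑ (λ x → c * f x) xs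
  ∑-*ˡ c f []       = *-zeroʳ c
  ∑-*ˡ c f (x ∷ xs) = trans (*-distribˡ-+ c (f x) _) (cong (c * f x +_) (∑-*ˡ c f xs))

  ∑-*ʳ : ∀ {A : Set} c (f : A → ℕ) xs → ∑ f xs * c ≡ ∑ (λ x → f x * c) xs
  ∑-*ʳ c f []       = refl
  ∑-*ʳ c f (x ∷ xs) = trans (*-distribʳ-+ c (f x) _) (cong (f x * c +_) (∑-*ʳ c f xs))

  ∑-const : ∀ {A : Set} c (xs : List A) → ∑ (λ _ → c) xs ≡ length xs * c
  ∑-const c []       = refl
  ∑-const c (x ∷ xs) = cong (c +_) (∑-const c xs)

  ∑-1 : ∀ {A : Set} (xs : List A) → ∑ (λ _ → 1) xs ≡ length xs
  ∑-1 xs = trans (∑-const 1 xs) (*-identityʳ _)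

  ∑-allFin-const : ∀ k c → ∑ (λ _ → c) (allFin k) ≡ k * c
  ∑-allFin-const k c = trans (∑-const c (allFin k)) (cong (_* c) (length-tabulate {n = k} id))

  ∏-const : ∀ {A : Set} c (xs : List A) → ∏ (λ _ → c) xs ≡ c ^ length xs
  ∏-const c []       = refl
  ∏-const c (x ∷ xs) = cong (c *_) (∏-const c xs)

  length-filter : ∀ {A : Set} {P : A → Set} (P? : ∀ x → Dec (P x)) xs →
                  length (filter P? xs) ≡ ∑ (λ x → if does (P? x) then 1 else 0) xs
  length-filter P? []       = refl
  length-filter P? (x ∷ xs) with does (P? x)
  ... | true  = cong suc (length-filter P? xs)
  ... | false = length-filter P? xs

  any?-indicator : ∀ {A : Set} {P : A → Set} (P? : ∀ x → Dec (P x)) xs →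
                   (if does (any? P? xs) then 1 else 0) + ∏ (λ x → if does (P? x) then 0 else 1) xs ≡ 1
  any?-indicator P? []       = refl
  any?-indicator P? (x ∷ xs) with does (P? x)
  ... | true  = refl
  ... | false = trans (cong ((if does (any? P? xs) then 1 else 0) +_) (+-identityʳ _)) (any?-indicator P? xs)

  ∑-allVecs-∏ : ∀ {A : Set} (L : List A) k (G : Fin k → A → ℕ) →
    ∑ (λ v → ∏ (λ x → G x (lookup v x)) (allFin k)) (allVecs L k) ≡ ∏ (λ x → ∑ (G x) L) (allFin k)
  ∑-allVecs-∏ L zero    G = refl
  ∑-allVecs-∏ L (suc k) G = begin
    ∑ (λ v → ∏ (λ x → G x (lookup v x)) (allFin (suc k))) (allVecs L (suc k))
      ≡⟨ ∑-allVecs-suc L k _ ⟩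
    ∑ (λ s → ∑ (λ v → ∏ (λ x → G x (lookup (s ∷ v) x)) (allFin (suc k))) (allVecs L k)) L
      ≡⟨ ∑-cong L (λ s → ∑-cong (allVecs L k) (λ v → ∏-allFin-suc (λ x → G x (lookup (s ∷ v) x)))) ⟩
    ∑ (λ s → ∑ (λ v → G zero s * ∏ (λ x → G (suc x) (lookup v x)) (allFin k)) (allVecs L k)) L
      ≡⟨ ∑-cong L (λ s → sym (∑-*ˡ (G zero s) _ (allVecs L k))) ⟩
    ∑ (λ s → G zero s * ∑ (λ v → ∏ (λ x → G (suc x) (lookup v x)) (allFin k)) (allVecs L k)) L
      ≡⟨ ∑-cong L (λ s → cong (G zero s *_) (∑-allVecs-∏ L k (G ∘ suc))) ⟩
    ∑ (λ s → G zero s * ∏ (λ x → ∑ (G (suc x)) L) (allFin k)) L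
      ≡⟨ ∑-*ʳ _ (G zero) L ⟨
    ∑ (G zero) L * ∏ (λ x → ∑ (G (suc x)) L) (allFin k)
      ≡⟨ ∏-allFin-suc (λ x → ∑ (G x) L) ⟨
    ∏ (λ x → ∑ (G x) L) (allFin (suc k)) ∎
    where open ≡-Reasoning

  rot-zero : ∀ {D} (x : Fin (suc D)) → rot zero x ≡ x
  rot-zero {D} x = toℕ-injective (begin
    toℕ (rot zero x)         ≡⟨ toℕ-fromℕ< _ ⟩
    (toℕ x + 0) % suc D      ≡⟨ cong (_% suc D) (+-identityʳ (toℕ x)) ⟩
    toℕ x % suc D            ≡⟨ m<n⇒m%n≡m (toℕ<n x) ⟩
    toℕ x                    ∎)
    where open ≡-Reasoning

  -- Writing toℕ x + toℕ r = toℕ x + q * d, the rotation r is a multiple of d below d.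
  rot-fixed : ∀ {D} (r x : Fin (suc D)) → rot r x ≡ x → r ≡ zero
  rot-fixed {D} r x rx≡x = toℕ-injective (begin
    toℕ r    ≡⟨ r≡q*d ⟩
    q * d    ≡⟨ cong (_* d) (n<1⇒n≡0 q<1) ⟩
    0        ∎)
    where
    open ≡-Reasoning
    d = suc D
    s = toℕ x + toℕ r
    q = s / d
    r≡q*d : toℕ r ≡ q * d
    r≡q*d = +-cancelˡ-≡ (toℕ x) _ _ (begin
      toℕ x + toℕ r     ≡⟨ m≡m%n+[m/n]*n s d ⟩
      s % d + q * d     ≡⟨ cong (_+ q * d) (trans (sym (toℕ-fromℕ< _)) (cong toℕ rx≡x)) ⟩
      toℕ x + q * d     ∎)
    q<1 : q < 1
    q<1 = *-cancelʳ-< d q 1 (subst₂ _<_ r≡q*d (sym (*-identityˡ d)) (toℕ<n r))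

  module _ (D : ℕ) where

    private
      d = suc D

    fixed? : ∀ n (g : Elem d n) (p : Pt d n) → Dec (act n g p ≡ p)
    fixed? n g p = ≡-dec _≟ᶠ_ (act n g p) p

    weight : ∀ n → ℕ → ℕ → Elem d n → ℕ
    weight n a b g = ∏ (λ p → if does (fixed? n g p) then a else b) (allPts d n)

    W : ℕ → ℕ → ℕ → ℕ
    W n a b = ∑ (weight n a b) (allElems d n)

    fixed?-cons : ∀ n π t x (i : Pt d n) →
                  does (fixed? (suc n) (π , t) (x ∷ i)) ≡ does (fixed? n π i) ∧ does (look n t i ≟ᶠ zero)
    fixed?-cons n π t x i = does-⇔ (mk⇔ to from) (fixed? (suc n) (π , t) (x ∷ i)) (fixed? n π i ×-dec look n t i ≟ᶠ zero)
      where
      to : act (suc n) (π , t) (x ∷ i) ≡ x ∷ i → act n π i ≡ i × look n t i ≡ zero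
      to eq with ∷-injective eq
      ... | rx≡x , πi≡i = πi≡i , rot-fixed _ x rx≡x
      from : act n π i ≡ i × look n t i ≡ zero → act (suc n) (π , t) (x ∷ i) ≡ x ∷ i
      from (πi≡i , ti≡0) = cong₂ _∷_ (trans (cong (λ r → rot r x) ti≡0) (rot-zero x)) πi≡i

    -- By fixed?-cons, whether x ∷ i is fixed does not depend on x, so the product over x is a d-th power.
    weight-suc : ∀ n a b π t → weight (suc n) a b (π , t) ≡
      ∏ (λ i → if does (fixed? n π i) then (if does (look n t i ≟ᶠ zero) then a ^ d else b ^ d) else b ^ d) (allPts d n)
    weight-suc n a b π t = begin
      ∏ w (allPts d (suc n))                          ≡⟨ ∏-allVecs-suc (allFin d) n w ⟩
      ∏ (λ x → ∏ (λ i → w (x ∷ i)) (allPts d n)) (allFin d) ≡⟨ ∏-swap (λ x i → w (x ∷ i)) (allFin d) (allPts d n) ⟩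
      ∏ (λ i → ∏ (λ x → w (x ∷ i)) (allFin d)) (allPts d n) ≡⟨ ∏-cong (allPts d n) power ⟩
      _                                                ∎
      where
      open ≡-Reasoning
      w : Pt d (suc n) → ℕ
      w p = if does (fixed? (suc n) (π , t) p) then a else b
      power : ∀ i → ∏ (λ x → w (x ∷ i)) (allFin d) ≡ _
      power i = begin
        ∏ (λ x → w (x ∷ i)) (allFin d)      ≡⟨ ∏-cong (allFin d) (λ x → cong (λ β → if β then a else b) (fixed?-cons n π t x i)) ⟩
        ∏ (λ _ → if β then a else b) (allFin d) ≡⟨ ∏-const (if β then a else b) (allFin d) ⟩
        (if β then a else b) ^ length (allFin d) ≡⟨ cong ((if β then a else b) ^_) (length-tabulate {n = d} id) ⟩
        (if β then a else b) ^ d                ≡⟨ if-float (_^ d) β ⟩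
        (if β then a ^ d else b ^ d)            ≡⟨ if-∧ (does (fixed? n π i)) ⟩
        _ ∎
        where β = does (fixed? n π i) ∧ does (look n t i ≟ᶠ zero)

    ∑-allTabs-∏ : ∀ n (f : Pt d n → Fin d → ℕ) →
      ∑ (λ t → ∏ (λ i → f i (look n t i)) (allPts d n)) (allTabs d n) ≡ ∏ (λ i → ∑ (f i) (allFin d)) (allPts d n)
    ∑-allTabs-∏ zero    f = trans (∑-cong (allFin d) (λ t → *-identityʳ (f [] t))) (sym (*-identityʳ _))
    ∑-allTabs-∏ (suc n) f = begin
      ∑ (λ t → ∏ (λ i → f i (look (suc n) t i)) (allPts d (suc n))) (allTabs d (suc n))
        ≡⟨ ∑-cong (allTabs d (suc n)) (λ t → ∏-allVecs-suc (allFin d) n _) ⟩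
      ∑ (λ t → ∏ (λ x → ∏ (λ v → f (x ∷ v) (look n (lookup t x) v)) (allPts d n)) (allFin d)) (allTabs d (suc n))
        ≡⟨ ∑-allVecs-∏ (allTabs d n) d (λ x s → ∏ (λ v → f (x ∷ v) (look n s v)) (allPts d n)) ⟩
      ∏ (λ x → ∑ (λ s → ∏ (λ v → f (x ∷ v) (look n s v)) (allPts d n)) (allTabs d n)) (allFin d)
        ≡⟨ ∏-cong (allFin d) (λ x → ∑-allTabs-∏ n (λ v → f (x ∷ v))) ⟩
      ∏ (λ x → ∏ (λ v → ∑ (f (x ∷ v)) (allFin d)) (allPts d n)) (allFin d)
        ≡⟨ ∏-allVecs-suc (allFin d) n _ ⟨
      ∏ (λ i → ∑ (f i) (allFin d)) (allPts d (suc n)) ∎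
      where open ≡-Reasoning

    ∑-rotation : ∀ β A B →
      ∑ (λ r → if β then (if does (r ≟ᶠ zero) then A else B) else B) (allFin d) ≡ (if β then A + D * B else d * B)
    ∑-rotation true  A B = trans (∑-allFin-suc {D} (λ r → if does (r ≟ᶠ zero) then A else B)) (cong (A +_) (∑-allFin-const D B))
    ∑-rotation false A B = ∑-allFin-const d B

    W-suc : ∀ n a b → W (suc n) a b ≡ W n (a ^ d + D * b ^ d) (d * b ^ d)
    W-suc n a b = begin
      ∑ (weight (suc n) a b) (concatMap (λ π → map (π ,_) (allTabs d n)) (allElems d n))
        ≡⟨ ∑-concatMap (weight (suc n) a b) _ (allElems d n) ⟩
      ∑ (λ π → ∑ (weight (suc n) a b) (map (π ,_) (allTabs d n))) (allElems d n)
        ≡⟨ ∑-cong (allElems d n) sum-over-tables ⟩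
      W n (a ^ d + D * b ^ d) (d * b ^ d) ∎
      where
      open ≡-Reasoning
      sum-over-tables : ∀ π → ∑ (weight (suc n) a b) (map (π ,_) (allTabs d n)) ≡ weight n (a ^ d + D * b ^ d) (d * b ^ d) π
      sum-over-tables π = begin
        ∑ (weight (suc n) a b) (map (π ,_) (allTabs d n))  ≡⟨ ∑-map (weight (suc n) a b) (π ,_) (allTabs d n) ⟩
        ∑ (λ t → weight (suc n) a b (π , t)) (allTabs d n) ≡⟨ ∑-cong (allTabs d n) (weight-suc n a b π) ⟩
        ∑ (λ t → ∏ (λ i → f i (look n t i)) (allPts d n)) (allTabs d n) ≡⟨ ∑-allTabs-∏ n f ⟩
        ∏ (λ i → ∑ (f i) (allFin d)) (allPts d n) ≡⟨ ∏-cong (allPts d n) (λ i → ∑-rotation (does (fixed? n π i)) (a ^ d) (b ^ d)) ⟩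
        weight n (a ^ d + D * b ^ d) (d * b ^ d) π ∎
        where
        f : Pt d n → Fin d → ℕ
        f i r = if does (fixed? n π i) then (if does (r ≟ᶠ zero) then a ^ d else b ^ d) else b ^ d

    next : ℕ × ℕ → ℕ × ℕ
    next (a , b) = a ^ d + D * b ^ d , d * b ^ d

    W-iterate : ∀ n a b → W n a b ≡ proj₁ (iterate next (a , b) n)
    W-iterate zero    a b = trans (+-identityʳ _) (*-identityʳ a)
    W-iterate (suc n) a b = trans (W-suc n a b) (W-iterate n _ _)

    counts : ℕ → ℕ × ℕ
    counts = fold (0 , 1) next

    derangements order nonDerangements : ℕ → ℕ
    derangements n    = proj₁ (counts n)
    order n           = proj₂ (counts n)
    nonDerangements n = length (filter (hasFixedPoint? d n) (allElems d n))

    W-0-1 : ∀ n → W n 0 1 ≡ derangements n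
    W-0-1 n = trans (W-iterate n 0 1) (cong proj₁ (sym (iterate-is-fold (0 , 1) next n)))

    proj₂-fold-next : ∀ n a a′ b → proj₂ (fold (a , b) next n) ≡ proj₂ (fold (a′ , b) next n)
    proj₂-fold-next zero    a a′ b = refl
    proj₂-fold-next (suc n) a a′ b = cong (λ x → d * x ^ d) (proj₂-fold-next n a a′ b)

    -- next (b , b) = (d * b ^ d , d * b ^ d)
    proj₁-fold-next-diagonal : ∀ n b → proj₁ (fold (b , b) next n) ≡ proj₂ (fold (b , b) next n)
    proj₁-fold-next-diagonal zero    b = refl
    proj₁-fold-next-diagonal (suc n) b =
      cong (λ x → x ^ d + D * proj₂ (fold (b , b) next n) ^ d) (proj₁-fold-next-diagonal n b)

    length-allElems : ∀ n → length (allElems d n) ≡ order n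
    length-allElems n = begin
      length (allElems d n)              ≡⟨ ∑-1 (allElems d n) ⟨
      ∑ (λ _ → 1) (allElems d n)         ≡⟨ ∑-cong (allElems d n) weight-1-1 ⟨
      W n 1 1                            ≡⟨ W-iterate n 1 1 ⟩
      proj₁ (iterate next (1 , 1) n)     ≡⟨ cong proj₁ (iterate-is-fold (1 , 1) next n) ⟨
      proj₁ (fold (1 , 1) next n)        ≡⟨ proj₁-fold-next-diagonal n 1 ⟩
      proj₂ (fold (1 , 1) next n)        ≡⟨ proj₂-fold-next n 1 0 1 ⟩
      order n                            ∎
      where
      open ≡-Reasoning
      weight-1-1 : ∀ g → weight n 1 1 g ≡ 1
      weight-1-1 g = trans (∏-cong (allPts d n) (λ p → if-eta (does (fixed? n g p)))) (∏-1 (allPts d n))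

    derangements+nonDerangements : ∀ n → derangements n + nonDerangements n ≡ order n
    derangements+nonDerangements n = begin
      derangements n + nonDerangements n   ≡⟨ +-comm (derangements n) _ ⟩
      nonDerangements n + derangements n   ≡⟨ cong₂ _+_ (length-filter (hasFixedPoint? d n) (allElems d n)) (sym (W-0-1 n)) ⟩
      ∑ indicator (allElems d n) + W n 0 1 ≡⟨ ∑-+ indicator (weight n 0 1) (allElems d n) ⟨
      ∑ (λ g → indicator g + weight n 0 1 g) (allElems d n) ≡⟨ ∑-cong (allElems d n) (λ g → any?-indicator (fixed? n g) (allPts d n)) ⟩
      ∑ (λ _ → 1) (allElems d n)           ≡⟨ ∑-1 (allElems d n) ⟩
      length (allElems d n)                ≡⟨ length-allElems n ⟩
      order n                              ∎
      where
      open ≡-Reasoning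
      indicator : Elem d n → ℕ
      indicator g = if does (hasFixedPoint? d n g) then 1 else 0

module GeometricSum where

  open import Data.Nat using (ℕ; zero; suc; _+_; _*_; _^_; _≤_; s≤s; z≤n)
  open import Data.Nat.Properties
  open import Data.Nat.Tactic.RingSolver using (solve-∀)
  open import Relation.Binary.PropositionalEquality

  -- geomSum m a b = Σ_{i<m} a^(m-1-i) b^i = (b^m - a^m) / (b - a)
  geomSum : ℕ → ℕ → ℕ → ℕ
  geomSum zero    a b = 0
  geomSum (suc m) a b = a ^ m + b * geomSum m a b

  pow-telescope : ∀ m a c {b} → a + c ≡ b → b ^ m ≡ a ^ m + c * geomSum m a b
  pow-telescope zero    a c _ = cong suc (sym (*-zeroʳ c))
  pow-telescope (suc m) a c {b} a+c≡b = begin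
    b * b ^ m                  ≡⟨ cong (b *_) (pow-telescope m a c a+c≡b) ⟩
    b * (A + c * G)            ≡⟨ cong (λ x → x * (A + c * G)) (sym a+c≡b) ⟩
    (a + c) * (A + c * G)      ≡⟨ regroup a c A G ⟩
    a * A + c * (A + (a + c) * G) ≡⟨ cong (λ x → a * A + c * (A + x * G)) a+c≡b ⟩
    a * A + c * (A + b * G)    ∎
    where
    open ≡-Reasoning
    A = a ^ m
    G = geomSum m a b
    regroup : ∀ a c A G → (a + c) * (A + c * G) ≡ a * A + c * (A + (a + c) * G)
    regroup = solve-∀

  geomSum-pos : ∀ m {a b} → 1 ≤ b → 1 ≤ geomSum (suc m) a b
  geomSum-pos zero    _   = s≤s z≤n
  geomSum-pos (suc m) {a} 1≤b = ≤-trans (*-mono-≤ 1≤b (geomSum-pos m 1≤b)) (m≤n+m _ (a ^ suc m))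

  geomSum-upper : ∀ m {a b} → a ≤ b → geomSum (suc m) a b ≤ suc m * b ^ m
  geomSum-upper zero    {b = b} _   = ≤-reflexive (cong suc (*-zeroʳ b))
  geomSum-upper (suc m) {a} {b} a≤b = begin
    a ^ suc m + b * geomSum (suc m) a b ≤⟨ +-mono-≤ (^-monoˡ-≤ (suc m) a≤b) (*-monoʳ-≤ b (geomSum-upper m a≤b)) ⟩
    b * B + b * ((1 + m) * B)           ≡⟨ collect m b B ⟩
    (2 + m) * (b * B)                   ∎
    where
    open ≤-Reasoning
    B = b ^ m
    collect : ∀ m b B → b * B + b * ((1 + m) * B) ≡ (2 + m) * (b * B)
    collect = solve-∀

  geomSum-lower : ∀ m {a b} → a ≤ b → suc m * a ^ suc m ≤ b * geomSum (suc m) a b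
  geomSum-lower zero    {a} {b} a≤b = begin
    1 * (a * 1)        ≡⟨ trans (*-identityˡ _) (*-identityʳ a) ⟩
    a                  ≤⟨ a≤b ⟩
    b                  ≡⟨ *-identityʳ b ⟨
    b * 1              ≡⟨ cong (λ x → b * suc x) (*-zeroʳ b) ⟨
    b * (1 + b * 0)    ∎
    where open ≤-Reasoning
  geomSum-lower (suc m) {a} {b} a≤b = begin
    (2 + m) * (a * A)              ≡⟨ split m a A ⟩
    a * A + a * ((1 + m) * A)      ≤⟨ +-mono-≤ (*-monoˡ-≤ A a≤b) (*-monoˡ-≤ ((1 + m) * A) a≤b) ⟩
    b * A + b * ((1 + m) * A)      ≤⟨ +-monoʳ-≤ (b * A) (*-monoʳ-≤ b (geomSum-lower m a≤b)) ⟩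
    b * A + b * (b * G)            ≡⟨ *-distribˡ-+ b A (b * G) ⟨
    b * (A + b * G)                ∎
    where
    open ≤-Reasoning
    A = a ^ suc m
    G = geomSum (suc m) a b
    split : ∀ m a A → (2 + m) * (a * A) ≡ a * A + a * ((1 + m) * A)
    split = solve-∀

  geomSum-upper-sharp : ∀ m a c {b} → a + c ≡ b → (2 * b + m * c) * geomSum (suc m) a b ≤ 2 * suc m * b ^ suc m
  geomSum-upper-sharp zero    a c {b} _ = ≤-reflexive (base b c)
    where
    base : ∀ b c → (2 * b + 0 * c) * (1 + b * 0) ≡ 2 * 1 * (b * 1)
    base = solve-∀
  geomSum-upper-sharp (suc m) a c {b} a+c≡b = begin
    (2 * b + (1 + m) * c) * (A + b * G)                       ≡⟨ expand m b c A G ⟩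
    c * ((1 + m) * A) + b * ((2 * b + m * c) * G) + (2 * b * A + c * (b * G))
      ≤⟨ +-monoˡ-≤ _ (+-mono-≤ (*-monoʳ-≤ c (geomSum-lower m (m+n≤o⇒m≤o a (≤-reflexive a+c≡b)))) (*-monoʳ-≤ b IH)) ⟩
    c * (b * G) + b * (2 * (1 + m) * (A + c * G)) + (2 * b * A + c * (b * G)) ≡⟨ collect m b c A G ⟩
    2 * (2 + m) * (b * (A + c * G))                           ≡⟨ cong (λ x → 2 * (2 + m) * (b * x)) (pow-telescope (suc m) a c a+c≡b) ⟨
    2 * (2 + m) * (b * b ^ suc m)                             ∎
    where
    open ≤-Reasoning
    A = a ^ suc m
    G = geomSum (suc m) a b
    IH : (2 * b + m * c) * G ≤ 2 * (1 + m) * (A + c * G)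
    IH = subst (λ x → (2 * b + m * c) * G ≤ 2 * (1 + m) * x) (pow-telescope (suc m) a c a+c≡b) (geomSum-upper-sharp m a c a+c≡b)
    expand : ∀ m b c A G → (2 * b + (1 + m) * c) * (A + b * G) ≡
             c * ((1 + m) * A) + b * ((2 * b + m * c) * G) + (2 * b * A + c * (b * G))
    expand = solve-∀
    collect : ∀ m b c A G → c * (b * G) + b * (2 * (1 + m) * (A + c * G)) + (2 * b * A + c * (b * G)) ≡
              2 * (2 + m) * (b * (A + c * G))
    collect = solve-∀

  geomSum-lower-sharp : ∀ m a c {b} → a + c ≡ b → 2 * suc m * b ^ suc m ≤ 2 * b * geomSum (suc m) a b + suc m * m * b ^ m * c
  geomSum-lower-sharp zero    a c {b} _ = ≤-reflexive (base b c)
    where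
    base : ∀ b c → 2 * 1 * (b * 1) ≡ 2 * b * (1 + b * 0) + 1 * 0 * 1 * c
    base = solve-∀
  geomSum-lower-sharp (suc m) a c {b} a+c≡b = begin
    2 * (2 + m) * (b * B)                               ≡⟨ split m b B ⟩
    b * (2 * (1 + m) * B) + 2 * b * B                   ≤⟨ +-mono-≤ (*-monoʳ-≤ b (geomSum-lower-sharp m a c a+c≡b)) last ⟩
    b * (2 * b * G + (1 + m) * m * P * c) + 2 * b * (A + c * ((1 + m) * P)) ≡⟨ collect m b c A G P ⟩
    2 * b * (A + b * G) + (2 + m) * (1 + m) * (b * P) * c ∎
    where
    open ≤-Reasoning
    A = a ^ suc m
    G = geomSum (suc m) a b
    P = b ^ m
    B = b ^ suc m
    last : 2 * b * B ≤ 2 * b * (A + c * ((1 + m) * P))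
    last = begin
      2 * b * B              ≡⟨ cong (2 * b *_) (pow-telescope (suc m) a c a+c≡b) ⟩
      2 * b * (A + c * G)    ≤⟨ *-monoʳ-≤ (2 * b) (+-monoʳ-≤ A (*-monoʳ-≤ c (geomSum-upper m (m+n≤o⇒m≤o a (≤-reflexive a+c≡b))))) ⟩
      2 * b * (A + c * ((1 + m) * P)) ∎
    split : ∀ m b B → 2 * (2 + m) * (b * B) ≡ b * (2 * (1 + m) * B) + 2 * b * B
    split = solve-∀
    collect : ∀ m b c A G P → b * (2 * b * G + (1 + m) * m * P * c) + 2 * b * (A + c * ((1 + m) * P)) ≡
              2 * b * (A + b * G) + (2 + m) * (1 + m) * (b * P) * c
    collect = solve-∀

module Recurrence where

  open Counting using (derangements; order; nonDerangements; derangements+nonDerangements)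
  open GeometricSum
  open import Data.Nat using (ℕ; zero; suc; _+_; _*_; _^_; _≤_; _<_; s≤s; z≤n; >-nonZero)
  open import Data.Nat.Properties
  open import Data.Nat.Tactic.RingSolver using (solve-∀)
  open import Relation.Binary.PropositionalEquality
  open import Algebra.Properties.CommutativeSemigroup +-commutativeSemigroup using (xy∙z≈xz∙y)

  module _ (D : ℕ) where

    private
      d = suc D
      a b c : ℕ → ℕ
      a = derangements D
      b = order D
      c = nonDerangements D
      a+c≡b : ∀ n → a n + c n ≡ b n
      a+c≡b = derangements+nonDerangements D

    -- a′ + c′ = b′ with a′ = a ^ d + D b ^ d and b′ = b ^ d + D b ^ d, so c′ = b ^ d - a ^ d.
    nonDerangements-suc : ∀ n → c (suc n) ≡ c n * geomSum d (a n) (b n)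
    nonDerangements-suc n = +-cancelˡ-≡ (a n ^ d + D * B) _ _ (begin
      (a n ^ d + D * B) + c (suc n)                ≡⟨ a+c≡b (suc n) ⟩
      B + D * B                                    ≡⟨ cong (_+ D * B) (pow-telescope d (a n) (c n) (a+c≡b n)) ⟩
      (a n ^ d + c n * geomSum d (a n) (b n)) + D * B ≡⟨ xy∙z≈xz∙y (a n ^ d) _ (D * B) ⟩
      (a n ^ d + D * B) + c n * geomSum d (a n) (b n) ∎)
      where
      open ≡-Reasoning
      B = b n ^ d

    order-1 : b 1 ≡ d
    order-1 = trans (cong (d *_) (^-zeroˡ d)) (*-identityʳ d)

    nonDerangements-1 : c 1 ≡ 1
    nonDerangements-1 = trans (+-cancelˡ-≡ (D * 1 ^ d) _ _ (trans (a+c≡b 1) (+-comm (1 ^ d) _))) (^-zeroˡ d)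

    private
      n<2*m⇒0<m : ∀ {n} m → n < 2 * m → 0 < m
      n<2*m⇒0<m (suc m) _ = s≤s z≤n

    nonDerangements-upper-step : ∀ k a c {b} → a + c ≡ b → D * (1 + k) * c < 2 * b →
                 D * (2 + k) * (c * geomSum d a b) < 2 * (d * b ^ d)
    nonDerangements-upper-step k a c {b} a+c≡b hyp = begin-strict
      D * (2 + k) * (c * G)               <⟨ m<m+n _ (geomSum-pos D (n<2*m⇒0<m b hyp)) ⟩
      D * (2 + k) * (c * G) + G           ≡⟨ regroup D k c G ⟩
      (1 + D * (1 + k) * c + D * c) * G   ≤⟨ *-monoˡ-≤ G (+-monoˡ-≤ (D * c) hyp) ⟩
      (2 * b + D * c) * G                 ≤⟨ geomSum-upper-sharp D a c a+c≡b ⟩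
      2 * d * b ^ d                       ≡⟨ *-assoc 2 d _ ⟩
      2 * (d * b ^ d)                     ∎
      where
      open ≤-Reasoning
      G = geomSum d a b
      regroup : ∀ D k c G → D * (2 + k) * (c * G) + G ≡ (1 + D * (1 + k) * c + D * c) * G
      regroup = solve-∀

    nonDerangements-upper : ∀ k → D * (2 + k) * c (suc k) < 2 * b (suc k)
    nonDerangements-upper zero = subst₂ (λ x y → D * 2 * x < 2 * y) (sym nonDerangements-1) (sym order-1)
      (subst (_< 2 * d) (trans (*-comm 2 D) (sym (*-identityʳ (D * 2)))) (*-monoʳ-< 2 (n<1+n D)))
    nonDerangements-upper (suc k) = subst (λ x → D * (3 + k) * x < 2 * b (2 + k)) (sym (nonDerangements-suc (suc k)))
      (nonDerangements-upper-step (suc k) (a (suc k)) (c (suc k)) (a+c≡b (suc k)) (nonDerangements-upper k))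

    nonDerangements-pos : ∀ k → 0 < c (suc k)
    nonDerangements-pos zero    = ≤-reflexive (sym nonDerangements-1)
    nonDerangements-pos (suc k) = subst (0 <_) (sym (nonDerangements-suc (suc k)))
      (*-mono-≤ (nonDerangements-pos k) (geomSum-pos D (n<2*m⇒0<m (b (suc k)) (nonDerangements-upper k))))

    geomSum-lower-sharp′ : ∀ a c {b} → a + c ≡ b → 2 * b * (d * b ^ D) ≤ 2 * b * geomSum d a b + D * c * (d * b ^ D)
    geomSum-lower-sharp′ a c {b} a+c≡b =
      subst₂ _≤_ (move-d D b (b ^ D)) (move-d² D b c _ (b ^ D)) (geomSum-lower-sharp D a c a+c≡b)
      where
      move-d : ∀ D b B → 2 * suc D * (b * B) ≡ 2 * b * (suc D * B)
      move-d = solve-∀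
      move-d² : ∀ D b c G B → 2 * b * G + suc D * D * B * c ≡ 2 * b * G + D * c * (suc D * B)
      move-d² = solve-∀

    -- Multiply the sharp lower bound by 1 + n; the hypothesis absorbs its error term.
    pow≤geomSum : ∀ n a c {b} → a + c ≡ b → D * (1 + n) * c < 2 * b → n * (d * b ^ D) ≤ (1 + n) * geomSum d a b
    pow≤geomSum n a c {b} a+c≡b hyp = *-cancelˡ-≤ (2 * b) {{>-nonZero (*-monoʳ-< 2 (n<2*m⇒0<m b hyp))}}
      (+-cancelʳ-≤ (2 * b * P) _ _ (begin
        2 * b * (n * P) + 2 * b * P                   ≡⟨ factor n b P ⟩
        (1 + n) * (2 * b * P)                         ≤⟨ *-monoʳ-≤ (1 + n) (geomSum-lower-sharp′ a c a+c≡b) ⟩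
        (1 + n) * (2 * b * G + D * c * P)             ≡⟨ expand n b G D c P ⟩
        2 * b * ((1 + n) * G) + D * (1 + n) * c * P   ≤⟨ +-monoʳ-≤ (2 * b * ((1 + n) * G)) (*-monoˡ-≤ P (<⇒≤ hyp)) ⟩
        2 * b * ((1 + n) * G) + 2 * b * P             ∎))
      where
      open ≤-Reasoning
      P = d * b ^ D
      G = geomSum d a b
      factor : ∀ n b P → 2 * b * (n * P) + 2 * b * P ≡ (1 + n) * (2 * b * P)
      factor = solve-∀
      expand : ∀ n b G D c P → (1 + n) * (2 * b * G + D * c * P) ≡ 2 * b * ((1 + n) * G) + D * (1 + n) * c * P
      expand = solve-∀

    -- With b′ = d b ^ d and c′ = c G, this is 2 b′ / (D c′) ≤ 2 b / (D c) + (1 + n) / n with denominators cleared.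
    nonDerangements-ratio-step : ∀ n a c {b} → a + c ≡ b → D * (1 + n) * c < 2 * b →
      2 * (d * b ^ d) * (D * c * n) ≤ (2 * b * n + (1 + n) * (D * c)) * (D * (c * geomSum d a b))
    nonDerangements-ratio-step n a c {b} a+c≡b hyp = begin
      2 * (d * (b * B)) * (D * c * n)                       ≡⟨ regroup D b B c n ⟩
      D * c * (n * (2 * b * (d * B)))                       ≤⟨ *-monoʳ-≤ (D * c) (*-monoʳ-≤ n (geomSum-lower-sharp′ a c a+c≡b)) ⟩
      D * c * (n * (2 * b * G + D * c * (d * B)))           ≡⟨ expand D c n b G B ⟩
      D * c * (2 * b * n * G + D * c * (n * (d * B)))
        ≤⟨ *-monoʳ-≤ (D * c) (+-monoʳ-≤ (2 * b * n * G) (*-monoʳ-≤ (D * c) (pow≤geomSum n a c a+c≡b hyp))) ⟩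
      D * c * (2 * b * n * G + D * c * ((1 + n) * G))       ≡⟨ collect D c n b G ⟩
      (2 * b * n + (1 + n) * (D * c)) * (D * (c * G))       ∎
      where
      open ≤-Reasoning
      B = b ^ D
      G = geomSum d a b
      regroup : ∀ D b B c n → 2 * (suc D * (b * B)) * (D * c * n) ≡ D * c * (n * (2 * b * (suc D * B)))
      regroup = solve-∀
      expand : ∀ D c n b G B → D * c * (n * (2 * b * G + D * c * (suc D * B))) ≡ D * c * (2 * b * n * G + D * c * (n * (suc D * B)))
      expand = solve-∀
      collect : ∀ D c n b G → D * c * (2 * b * n * G + D * c * ((1 + n) * G)) ≡ (2 * b * n + (1 + n) * (D * c)) * (D * (c * G))
      collect = solve-∀

    nonDerangements-ratio : ∀ k →
      2 * b (2 + k) * (D * c (1 + k) * (1 + k)) ≤ (2 * b (1 + k) * (1 + k) + (2 + k) * (D * c (1 + k))) * (D * c (2 + k))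
    nonDerangements-ratio k =
      subst (λ x → 2 * b (2 + k) * (D * c (1 + k) * (1 + k)) ≤ (2 * b (1 + k) * (1 + k) + (2 + k) * (D * c (1 + k))) * (D * x))
            (sym (nonDerangements-suc (1 + k)))
            (nonDerangements-ratio-step (1 + k) (a (1 + k)) (c (1 + k)) (a+c≡b (1 + k)) (nonDerangements-upper k))

    order-pos : ∀ k → 0 < b (suc k)
    order-pos k = n<2*m⇒0<m (b (suc k)) (nonDerangements-upper k)

module Fractions where

  open import Data.Nat as ℕ using (ℕ; zero; suc; z≤n; s≤s)
  import Data.Nat.Properties as ℕ
  open import Data.Nat.Tactic.RingSolver using (solve-∀)
  open import Data.Integer as ℤ using (+_; +≤+; +<+)
  import Data.Integer.Properties as ℤ
  open import Data.Rational.Unnormalised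
  open import Data.Rational.Unnormalised.Properties
  open import Data.Sum using (inj₁; inj₂)
  open import Relation.Binary.PropositionalEquality using (_≡_; sym; trans; cong; cong₂; subst₂)

  frac-≤ : ∀ x {y} u {v} → 0 ℕ.< y → 0 ℕ.< v → x ℕ.* v ℕ.≤ u ℕ.* y → frac (+ x) y ≤ frac (+ u) v
  frac-≤ x {suc y} u {suc v} _ _ h = *≤* (subst₂ ℤ._≤_ (ℤ.pos-* x (suc v)) (ℤ.pos-* u (suc y)) (+≤+ h))

  frac-< : ∀ x {y} u {v} → 0 ℕ.< y → 0 ℕ.< v → x ℕ.* v ℕ.< u ℕ.* y → frac (+ x) y < frac (+ u) v
  frac-< x {suc y} u {suc v} _ _ h = *<* (subst₂ ℤ._<_ (ℤ.pos-* x (suc v)) (ℤ.pos-* u (suc y)) (+<+ h))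

  frac-+ : ∀ x {y} u {v} → 0 ℕ.< y → 0 ℕ.< v → frac (+ x) y + frac (+ u) v ≡ frac (+ (x ℕ.* v ℕ.+ u ℕ.* y)) (y ℕ.* v)
  frac-+ x {suc y} u {suc v} _ _ = cong (λ z → mkℚᵘ z (v ℕ.+ y ℕ.* suc v))
    (trans (cong₂ ℤ._+_ (sym (ℤ.pos-* x (suc v))) (sym (ℤ.pos-* u (suc y)))) (sym (ℤ.pos-+ (x ℕ.* suc v) (u ℕ.* suc y))))

  frac-* : ∀ x {y} u {v} → 0 ℕ.< y → 0 ℕ.< v → frac (+ x) y * frac (+ u) v ≡ frac (+ (x ℕ.* u)) (y ℕ.* v)
  frac-* x {suc y} u {suc v} _ _ = cong (λ z → mkℚᵘ z (v ℕ.+ y ℕ.* suc v)) (sym (ℤ.pos-* x u))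

  frac-≃ : ∀ x {y} u {v} → 0 ℕ.< y → 0 ℕ.< v → x ℕ.* v ≡ u ℕ.* y → frac (+ x) y ≃ frac (+ u) v
  frac-≃ x {suc y} u {suc v} _ _ h = *≡* (trans (sym (ℤ.pos-* x (suc v))) (trans (cong +_ h) (ℤ.pos-* u (suc y))))

  *-frac-cancel : ∀ m x {y} → 0 ℕ.< m → 0 ℕ.< y → fromℕ m * frac (+ x) (m ℕ.* y) ≃ frac (+ x) y
  *-frac-cancel m x {y} 0<m 0<y = ≃-trans (≃-reflexive (frac-* m x (s≤s z≤n) 0<m*y))
    (frac-≃ (m ℕ.* x) x (ℕ.≤-trans 0<m*y (ℕ.≤-reflexive (sym (ℕ.*-identityˡ _)))) 0<y (identity m x y))
    where
    0<m*y = ℕ.*-mono-≤ 0<m 0<y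
    identity : ∀ m x y → m ℕ.* x ℕ.* y ≡ x ℕ.* (1 ℕ.* (m ℕ.* y))
    identity = solve-∀

  frac-nonNeg : ∀ x y → 0ℚᵘ ≤ frac (+ x) y
  frac-nonNeg x zero    = ≤-refl
  frac-nonNeg x (suc y) = frac-≤ 0 x (s≤s z≤n) (s≤s z≤n) z≤n

  fromℕ-nonNeg : ∀ n → 0ℚᵘ ≤ fromℕ n
  fromℕ-nonNeg n = frac-nonNeg n 1

  fromℕ-+ : ∀ m n → fromℕ m + fromℕ n ≃ fromℕ (m ℕ.+ n)
  fromℕ-+ m n = ≃-reflexive (trans (frac-+ m n (s≤s z≤n) (s≤s z≤n)) (cong (λ z → frac (+ z) 1) (cong₂ ℕ._+_ (ℕ.*-identityʳ m) (ℕ.*-identityʳ n))))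

  fromℕ-suc : ∀ n → fromℕ n + 1ℚᵘ ≃ fromℕ (suc n)
  fromℕ-suc n = ≃-trans (fromℕ-+ n 1) (≃-reflexive (cong fromℕ (ℕ.+-comm n 1)))

  fromℕ-mono-≤ : ∀ {m n} → m ℕ.≤ n → fromℕ m ≤ fromℕ n
  fromℕ-mono-≤ {m} {n} m≤n = frac-≤ m n (s≤s z≤n) (s≤s z≤n) (ℕ.*-monoˡ-≤ 1 m≤n)

  *-nonNeg : ∀ {p q} → 0ℚᵘ ≤ p → 0ℚᵘ ≤ q → 0ℚᵘ ≤ p * q
  *-nonNeg {p} {q} 0≤p 0≤q = ≤-respˡ-≃ (*-zeroˡ q) (*-monoˡ-≤-nonNeg q {{nonNegative 0≤q}} 0≤p)

  *-monoˡ-≤-0≤ : ∀ r {p q} → 0ℚᵘ ≤ r → p ≤ q → p * r ≤ q * r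
  *-monoˡ-≤-0≤ r 0≤r = *-monoˡ-≤-nonNeg r {{nonNegative 0≤r}}

  *-monoʳ-≤-0≤ : ∀ r {p q} → 0ℚᵘ ≤ r → p ≤ q → r * p ≤ r * q
  *-monoʳ-≤-0≤ r 0≤r = *-monoʳ-≤-nonNeg r {{nonNegative 0≤r}}

  p≤p+nonNeg : ∀ p {q} → 0ℚᵘ ≤ q → p ≤ p + q
  p≤p+nonNeg p 0≤q = ≤-respˡ-≃ (+-identityʳ p) (+-monoʳ-≤ p 0≤q)

  p+nonPos≤p : ∀ p {q} → q ≤ 0ℚᵘ → p + q ≤ p
  p+nonPos≤p p q≤0 = ≤-respʳ-≃ (+-identityʳ p) (+-monoʳ-≤ p q≤0)

  +-nonNeg : ∀ {p q} → 0ℚᵘ ≤ p → 0ℚᵘ ≤ q → 0ℚᵘ ≤ p + q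
  +-nonNeg {p} 0≤p 0≤q = ≤-trans 0≤p (p≤p+nonNeg p 0≤q)

  nonPos*nonNeg : ∀ {p q} → p ≤ 0ℚᵘ → 0ℚᵘ ≤ q → p * q ≤ 0ℚᵘ
  nonPos*nonNeg {p} {q} p≤0 0≤q = ≤-respʳ-≃ (*-zeroˡ q) (*-monoˡ-≤-0≤ q 0≤q p≤0)

  nonNeg*nonPos : ∀ {p q} → 0ℚᵘ ≤ p → q ≤ 0ℚᵘ → p * q ≤ 0ℚᵘ
  nonNeg*nonPos {p} {q} 0≤p q≤0 = ≤-respʳ-≃ (*-zeroʳ p) (*-monoʳ-≤-0≤ p 0≤p q≤0)

  square-nonNeg : ∀ p → 0ℚᵘ ≤ p * p
  square-nonNeg p with ≤-total 0ℚᵘ p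
  ... | inj₁ 0≤p = *-nonNeg 0≤p 0≤p
  ... | inj₂ p≤0 = ≤-respˡ-≃ (*-zeroʳ p) (*-monoʳ-≤-nonPos p {{nonPositive p≤0}} p≤0)

module ExponentialSeries where

  open Fractions
  open import Data.Nat as ℕ using (ℕ; zero; suc; z≤n; s≤s; _!)
  import Data.Nat.Properties as ℕ
  open import Data.Integer using (+_; +≤+; +<+)
  open import Data.Rational.Unnormalised
  open import Data.Rational.Unnormalised.Properties
  open import Data.Rational.Unnormalised.Solver using (module +-*-Solver)
  open import Data.Sum using (inj₁; inj₂; [_,_]′)
  open import Data.Product using (_×_; _,_; proj₁; proj₂)
  open import Relation.Binary.PropositionalEquality using (_≡_; refl; cong; subst)
  open +-*-Solver

  fact⁻¹ : ℕ → ℚᵘ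
  fact⁻¹ N = frac (+ 1) (N !)

  fact⁻¹-nonNeg : ∀ N → 0ℚᵘ ≤ fact⁻¹ N
  fact⁻¹-nonNeg N = frac-nonNeg 1 (N !)

  fact⁻¹-suc : ∀ N → fromℕ (suc N) * fact⁻¹ (suc N) ≃ fact⁻¹ N
  fact⁻¹-suc N = *-frac-cancel (suc N) 1 (s≤s z≤n) (ℕ.1≤n! N)

  pow-nonNeg : ∀ {q} k → 0ℚᵘ ≤ q → 0ℚᵘ ≤ pow q k
  pow-nonNeg zero    _   = *≤* (+≤+ z≤n)
  pow-nonNeg (suc k) 0≤q = *-nonNeg 0≤q (pow-nonNeg k 0≤q)

  pow-mono-≤ : ∀ {q r} k → 0ℚᵘ ≤ q → q ≤ r → pow q k ≤ pow r k
  pow-mono-≤ zero    _   _   = ≤-refl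
  pow-mono-≤ {q} {r} (suc k) 0≤q q≤r =
    ≤-trans (*-monoˡ-≤-0≤ (pow q k) (pow-nonNeg k 0≤q) q≤r) (*-monoʳ-≤-0≤ r (≤-trans 0≤q q≤r) (pow-mono-≤ k 0≤q q≤r))

  pow-cong : ∀ {q r} k → q ≃ r → pow q k ≃ pow r k
  pow-cong zero    _   = ≃-refl
  pow-cong (suc k) q≃r = *-cong q≃r (pow-cong k q≃r)

  expPartial-cong : ∀ {q r} N → q ≃ r → expPartial q N ≃ expPartial r N
  expPartial-cong zero    _   = ≃-refl
  expPartial-cong (suc N) q≃r = +-cong (expPartial-cong N q≃r) (*-congʳ (pow-cong N q≃r))

  expPartial-mono-≤ : ∀ {q r} N → 0ℚᵘ ≤ q → q ≤ r → expPartial q N ≤ expPartial r N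
  expPartial-mono-≤ zero    _   _   = ≤-refl
  expPartial-mono-≤ (suc N) 0≤q q≤r =
    +-mono-≤ (expPartial-mono-≤ N 0≤q q≤r) (*-monoˡ-≤-0≤ (fact⁻¹ N) (fact⁻¹-nonNeg N) (pow-mono-≤ N 0≤q q≤r))

  expPartial-≤-suc : ∀ {q} N → 0ℚᵘ ≤ q → expPartial q N ≤ expPartial q (suc N)
  expPartial-≤-suc {q} N 0≤q =
    p≤p+nonNeg (expPartial q N) (*-nonNeg (pow-nonNeg N 0≤q) (fact⁻¹-nonNeg N))

  expPartial-0 : ∀ N → expPartial 0ℚᵘ N ≤ 1ℚᵘ
  expPartial-0 zero          = *≤* (+≤+ z≤n)
  expPartial-0 (suc zero)    = ≤-refl
  expPartial-0 (suc (suc N)) = ≤-respˡ-≃ (≃-sym (drop-last (expPartial 0ℚᵘ (suc N)) (pow 0ℚᵘ N) (fact⁻¹ (suc N)))) (expPartial-0 (suc N))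
    where
    drop-last : ∀ s p f → s + (0ℚᵘ * p) * f ≃ s
    drop-last = solve 3 (λ s p f → s :+ (con 0ℚᵘ :* p) :* f := s) ≃-refl

  pow-+-≤ : ∀ {x h} N → 0ℚᵘ ≤ x → 0ℚᵘ ≤ h → pow (x + h) (suc N) ≤ pow x (suc N) + fromℕ (suc N) * h * pow (x + h) N
  pow-+-≤ {x} {h} zero    _ _ = ≤-reflexive (solve 2 (λ x h → (x :+ h) :* con 1ℚᵘ := x :* con 1ℚᵘ :+ con 1ℚᵘ :* h :* con 1ℚᵘ) ≃-refl x h)
  pow-+-≤ {x} {h} (suc N) 0≤x 0≤h = begin
    y * P                            ≃⟨ *-distribʳ-+ P x h ⟩
    x * P + h * P                    ≤⟨ +-monoˡ-≤ (h * P) (*-monoʳ-≤-0≤ x 0≤x (pow-+-≤ N 0≤x 0≤h)) ⟩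
    x * (Q + c * h * R) + h * P      ≃⟨ +-congˡ (h * P) (distribute x Q c h R) ⟩
    x * Q + c * h * (x * R) + h * P
      ≤⟨ +-monoˡ-≤ (h * P) (+-monoʳ-≤ (x * Q) (*-monoʳ-≤-0≤ (c * h) (*-nonNeg (fromℕ-nonNeg (suc N)) 0≤h) x*R≤P)) ⟩
    x * Q + c * h * P + h * P        ≃⟨ collect (x * Q) c h P ⟩
    x * Q + (c + 1ℚᵘ) * h * P        ≃⟨ +-congʳ (x * Q) (*-congʳ {P} (*-congʳ {h} (fromℕ-suc (suc N)))) ⟩
    x * Q + fromℕ (suc (suc N)) * h * P ∎
    where
    open ≤-Reasoning
    y = x + h
    P = pow y (suc N)
    Q = pow x (suc N)
    R = pow y N
    c = fromℕ (suc N)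
    x*R≤P : x * R ≤ P
    x*R≤P = *-monoˡ-≤-0≤ R (pow-nonNeg N (+-nonNeg 0≤x 0≤h)) (p≤p+nonNeg x 0≤h)
    distribute : ∀ x Q c h R → x * (Q + c * h * R) ≃ x * Q + c * h * (x * R)
    distribute = solve 5 (λ x Q c h R → x :* (Q :+ c :* h :* R) := x :* Q :+ c :* h :* (x :* R)) ≃-refl
    collect : ∀ a c h P → a + c * h * P + h * P ≃ a + (c + 1ℚᵘ) * h * P
    collect = solve 4 (λ a c h P → a :+ c :* h :* P :+ h :* P := a :+ (c :+ con 1ℚᵘ) :* h :* P) ≃-refl

  -- Termwise, (x + h) ^ (k + 1) / (k + 1)! ≤ x ^ (k + 1) / (k + 1)! + h * (x + h) ^ k / k!.
  expPartial-suc-+-≤ : ∀ {x h} N → 0ℚᵘ ≤ x → 0ℚᵘ ≤ h →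
                       expPartial (x + h) (suc N) ≤ expPartial x (suc N) + h * expPartial (x + h) N
  expPartial-suc-+-≤ {x} {h} zero    _   _   = ≤-reflexive (solve 2 (λ s h → s := s :+ h :* con 0ℚᵘ) ≃-refl (expPartial x 1) h)
  expPartial-suc-+-≤ {x} {h} (suc N) 0≤x 0≤h = begin
    S′ y + pow y (suc N) * f′
      ≤⟨ +-mono-≤ (expPartial-suc-+-≤ N 0≤x 0≤h) (*-monoˡ-≤-0≤ f′ (fact⁻¹-nonNeg (suc N)) (pow-+-≤ N 0≤x 0≤h)) ⟩
    (S′ x + h * S y) + (pow x (suc N) + c * h * pow y N) * f′
      ≃⟨ regroup (S′ x) h (S y) (pow x (suc N)) c (pow y N) f′ ⟩
    (S′ x + pow x (suc N) * f′) + h * (S y + pow y N * (c * f′))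
      ≃⟨ +-congʳ (expPartial x (2 ℕ.+ N)) (*-congˡ {h} (+-congʳ (S y) (*-congˡ {pow y N} (fact⁻¹-suc N)))) ⟩
    expPartial x (2 ℕ.+ N) + h * expPartial y (suc N) ∎
    where
    open ≤-Reasoning
    y = x + h
    S S′ : ℚᵘ → ℚᵘ
    S  q = expPartial q N
    S′ q = expPartial q (suc N)
    c = fromℕ (suc N)
    f′ = fact⁻¹ (suc N)
    regroup : ∀ A h B X c R f → (A + h * B) + (X + c * h * R) * f ≃ (A + X * f) + h * (B + R * (c * f))
    regroup = solve 7 (λ A h B X c R f → (A :+ h :* B) :+ (X :+ c :* h :* R) :* f := (A :+ X :* f) :+ h :* (B :+ R :* (c :* f))) ≃-refl

  expPartial-+-≤ : ∀ {x h} N → 0ℚᵘ ≤ x → 0ℚᵘ ≤ h → expPartial (x + h) N ≤ expPartial x N + h * expPartial (x + h) N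
  expPartial-+-≤ {x} {h} zero    _   _   = ≤-reflexive (solve 1 (λ h → con 0ℚᵘ := con 0ℚᵘ :+ h :* con 0ℚᵘ) ≃-refl h)
  expPartial-+-≤ {x} {h} (suc N) 0≤x 0≤h = ≤-trans (expPartial-suc-+-≤ N 0≤x 0≤h)
    (+-monoʳ-≤ (expPartial x (suc N)) (*-monoʳ-≤-0≤ h 0≤h (expPartial-≤-suc N (+-nonNeg 0≤x 0≤h))))

  -- From e^(x + h) (1 - h) ≤ e^x with h = 1/(k + 2): the bound k + 1 on e^x becomes k + 2 on e^(x + h).
  expPartial-step : ∀ k {x} → 0ℚᵘ ≤ x → (∀ N → expPartial x N ≤ fromℕ (suc k)) →
                    ∀ N → expPartial (x + frac (+ 1) (2 ℕ.+ k)) N ≤ fromℕ (2 ℕ.+ k)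
  expPartial-step k {x} 0≤x bound N = *-cancelˡ-≤-pos a (add-cancelʳ (begin
    a * s + s          ≃⟨ solve 2 (λ a s → a :* s :+ s := (a :+ con 1ℚᵘ) :* s) ≃-refl a s ⟩
    (a + 1ℚᵘ) * s      ≃⟨ *-congʳ {s} (fromℕ-suc (suc k)) ⟩
    b * s              ≤⟨ *-monoʳ-≤-0≤ b (fromℕ-nonNeg (2 ℕ.+ k)) s≤a+hs ⟩
    b * (a + h * s)    ≃⟨ solve 4 (λ a b h s → b :* (a :+ h :* s) := a :* b :+ (b :* h) :* s) ≃-refl a b h s ⟩
    a * b + b * h * s  ≃⟨ +-congʳ (a * b) (≃-trans (*-congʳ {s} b*h≃1) (*-identityˡ s)) ⟩
    a * b + s          ∎))
    where
    open ≤-Reasoning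
    a = fromℕ (suc k)
    b = fromℕ (2 ℕ.+ k)
    h = frac (+ 1) (2 ℕ.+ k)
    s = expPartial (x + h) N
    s≤a+hs : s ≤ a + h * s
    s≤a+hs = ≤-trans (expPartial-+-≤ N 0≤x (frac-nonNeg 1 (2 ℕ.+ k))) (+-monoˡ-≤ (h * s) (bound N))
    b*h≃1 : b * h ≃ 1ℚᵘ
    b*h≃1 = subst (λ y → b * frac (+ 1) y ≃ 1ℚᵘ) (ℕ.*-identityʳ (2 ℕ.+ k)) (*-frac-cancel (2 ℕ.+ k) 1 (s≤s z≤n) (s≤s z≤n))
    add-cancelʳ : ∀ {p q} → p + s ≤ q + s → p ≤ q
    add-cancelʳ {p} {q} p+s≤q+s = ≤-respʳ-≃ (cancel q) (≤-respˡ-≃ (cancel p) (+-monoˡ-≤ (- s) p+s≤q+s))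
      where
      cancel : ∀ p → p + s - s ≃ p
      cancel p = solve 2 (λ p s → p :+ s :- s := p) ≃-refl p s

  harmonic : ℕ → ℚᵘ
  harmonic zero    = 0ℚᵘ
  harmonic (suc k) = harmonic k + frac (+ 1) (suc k)

  1≤harmonic : ∀ k → 1ℚᵘ ≤ harmonic (suc k)
  1≤harmonic zero    = *≤* (+≤+ (s≤s z≤n))
  1≤harmonic (suc k) = ≤-trans (1≤harmonic k) (p≤p+nonNeg (harmonic (suc k)) (frac-nonNeg 1 (2 ℕ.+ k)))

  expPartial-harmonic : ∀ k N → expPartial (harmonic (suc k) - 1ℚᵘ) N ≤ fromℕ (suc k)
  expPartial-harmonic zero    N = ≤-respˡ-≃ (expPartial-cong N (*≡* refl)) (expPartial-0 N)
  expPartial-harmonic (suc k) N = ≤-respˡ-≃ (expPartial-cong N (shift (harmonic (suc k)) (frac (+ 1) (2 ℕ.+ k))))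
    (expPartial-step k (p≤q⇒0≤q-p (1≤harmonic k)) (expPartial-harmonic k) N)
    where
    shift : ∀ H f → (H - 1ℚᵘ) + f ≃ (H + f) - 1ℚᵘ
    shift = solve 2 (λ H f → (H :- con 1ℚᵘ) :+ f := (H :+ f) :- con 1ℚᵘ) ≃-refl

  series : (ℕ → ℚᵘ) → ℚᵘ → ℕ → ℚᵘ
  series a q zero    = 0ℚᵘ
  series a q (suc N) = series a q N + pow q N * a N

  expPartial≡series : ∀ q N → expPartial q N ≡ series fact⁻¹ q N
  expPartial≡series q zero    = refl
  expPartial≡series q (suc N) = cong (_+ pow q N * fact⁻¹ N) (expPartial≡series q N)

  series-cong : ∀ {a b} q N → (∀ k → k ℕ.< N → a k ≃ b k) → series a q N ≃ series b q N
  series-cong q zero    a≃b = ≃-refl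
  series-cong q (suc N) a≃b = +-cong (series-cong q N (λ k k<N → a≃b k (ℕ.m<n⇒m<1+n k<N))) (*-congˡ {pow q N} (a≃b N ℕ.≤-refl))

  *-series : ∀ r a q N → r * series a q N ≃ series (λ k → r * a k) q N
  *-series r a q zero    = *-zeroʳ r
  *-series r a q (suc N) = ≃-trans (*-distribˡ-+ r (series a q N) _)
    (+-cong (*-series r a q N) (solve 3 (λ r p a → r :* (p :* a) := p :* (r :* a)) ≃-refl r (pow q N) (a N)))

  -3≤q⇒0≤n+q : ∀ {n q} → 3 ℕ.≤ n → - fromℕ 3 ≤ q → 0ℚᵘ ≤ fromℕ n + q
  -3≤q⇒0≤n+q {n} {q} 3≤n -3≤q = ≤-respˡ-≃ (*≡* refl) (+-mono-≤ (fromℕ-mono-≤ 3≤n) -3≤q)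

  sosRemainder : ℚᵘ → ℚᵘ
  sosRemainder q = fromℕ 12 * ((fromℕ 19 * q + fromℕ 60) * (fromℕ 19 * q + fromℕ 60))
    + fromℕ 19 * (q * q * ((fromℕ 3 + q) * ((fromℕ 2 * q + fromℕ 3) * (fromℕ 2 * q + fromℕ 3) + fromℕ 75)))

  sosRemainder-nonNeg : ∀ {q} → - fromℕ 3 ≤ q → 0ℚᵘ ≤ sosRemainder q
  sosRemainder-nonNeg {q} -3≤q = +-nonNeg
    (*-nonNeg (fromℕ-nonNeg 12) (square-nonNeg (fromℕ 19 * q + fromℕ 60)))
    (*-nonNeg (fromℕ-nonNeg 19) (*-nonNeg (square-nonNeg q) (*-nonNeg (-3≤q⇒0≤n+q ℕ.≤-refl -3≤q)
      (+-nonNeg (square-nonNeg (fromℕ 2 * q + fromℕ 3)) (fromℕ-nonNeg 75)))))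

  -- 54720 = 6! * 76 clears the denominators of the partial sum.
  expPartial-7 : ∀ q → fromℕ 54720 * expPartial q 7 ≃ fromℕ 54720 + fromℕ 11520 * q + q * sosRemainder q
  expPartial-7 q = begin-equality
    fromℕ 54720 * expPartial q 7                 ≡⟨ cong (fromℕ 54720 *_) (expPartial≡series q 7) ⟩
    fromℕ 54720 * series fact⁻¹ q 7              ≃⟨ *-series (fromℕ 54720) fact⁻¹ q 7 ⟩
    series (λ k → fromℕ 54720 * fact⁻¹ k) q 7    ≃⟨ series-cong q 7 scaled ⟩
    series (λ k → fromℕ (c k)) q 7               ≃⟨ solve 1 (λ q →
        con 0ℚᵘ :+ q :^ 0 :* con (fromℕ 54720) :+ q :^ 1 :* con (fromℕ 54720) :+ q :^ 2 :* con (fromℕ 27360)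
          :+ q :^ 3 :* con (fromℕ 9120) :+ q :^ 4 :* con (fromℕ 2280) :+ q :^ 5 :* con (fromℕ 456) :+ q :^ 6 :* con (fromℕ 76)
        := con (fromℕ 54720) :+ con (fromℕ 11520) :* q
          :+ q :* (con (fromℕ 12) :* ((con (fromℕ 19) :* q :+ con (fromℕ 60)) :* (con (fromℕ 19) :* q :+ con (fromℕ 60)))
            :+ con (fromℕ 19) :* (q :* q :* ((con (fromℕ 3) :+ q)
              :* ((con (fromℕ 2) :* q :+ con (fromℕ 3)) :* (con (fromℕ 2) :* q :+ con (fromℕ 3)) :+ con (fromℕ 75))))))
        ≃-refl q ⟩
    fromℕ 54720 + fromℕ 11520 * q + q * sosRemainder q ∎
    where
    open ≤-Reasoning
    c : ℕ → ℕ
    c 0 = 54720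
    c 1 = 54720
    c 2 = 27360
    c 3 = 9120
    c 4 = 2280
    c 5 = 456
    c _ = 76
    scaled : ∀ k → k ℕ.< 7 → fromℕ 54720 * fact⁻¹ k ≃ fromℕ (c k)
    scaled 0 _ = *≡* refl
    scaled 1 _ = *≡* refl
    scaled 2 _ = *≡* refl
    scaled 3 _ = *≡* refl
    scaled 4 _ = *≡* refl
    scaled 5 _ = *≡* refl
    scaled 6 _ = *≡* refl
    scaled (suc (suc (suc (suc (suc (suc (suc _))))))) (s≤s (s≤s (s≤s (s≤s (s≤s (s≤s (s≤s ())))))))

  expPartial-7-≤ : ∀ {q} → - fromℕ 3 ≤ q → q ≤ 0ℚᵘ → expPartial q 7 ≤ 1ℚᵘ + frac (+ 4) 19 * q
  expPartial-7-≤ {q} -3≤q q≤0 = *-cancelˡ-≤-pos (fromℕ 54720) (begin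
    M * expPartial q 7                   ≃⟨ expPartial-7 q ⟩
    M + fromℕ 11520 * q + q * sosRemainder q ≤⟨ p+nonPos≤p _ (nonPos*nonNeg q≤0 (sosRemainder-nonNeg -3≤q)) ⟩
    M + fromℕ 11520 * q                  ≃⟨ +-congʳ M (*-congʳ {q} {fromℕ 11520} {M * κ} (*≡* refl)) ⟩
    M + M * κ * q                        ≃⟨ solve 3 (λ M κ q → M :+ M :* κ :* q := M :* (con 1ℚᵘ :+ κ :* q)) ≃-refl M κ q ⟩
    M * (1ℚᵘ + κ * q)                    ∎)
    where
    open ≤-Reasoning
    M = fromℕ 54720
    κ = frac (+ 4) 19

  module _ {q : ℚᵘ} (-3≤q : - fromℕ 3 ≤ q) (q≤0 : q ≤ 0ℚᵘ) where

    private
      S : ℕ → ℚᵘ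
      S = expPartial q

    expPartial-suc-≤ : ∀ N → pow q N ≤ 0ℚᵘ → S (suc N) ≤ S N
    expPartial-suc-≤ N qᴺ≤0 = p+nonPos≤p (S N) (nonPos*nonNeg qᴺ≤0 (fact⁻¹-nonNeg N))

    -- q ^ N / N! + q ^ (N + 1) / (N + 1)! = q ^ N (N + 1 + q) / (N + 1)!
    expPartial-suc-suc-≤ : ∀ N → 2 ℕ.≤ N → pow q N ≤ 0ℚᵘ → S (2 ℕ.+ N) ≤ S N
    expPartial-suc-suc-≤ N 2≤N qᴺ≤0 = begin
      S N + pow q N * fact⁻¹ N + q * pow q N * f′
        ≃⟨ +-congˡ (q * pow q N * f′) (+-congʳ (S N) (*-congˡ {pow q N} (≃-sym (fact⁻¹-suc N)))) ⟩
      S N + pow q N * (fromℕ (suc N) * f′) + q * pow q N * f′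
        ≃⟨ solve 5 (λ s p n q f → s :+ p :* (n :* f) :+ q :* p :* f := s :+ p :* ((n :+ q) :* f)) ≃-refl (S N) (pow q N) (fromℕ (suc N)) q f′ ⟩
      S N + pow q N * ((fromℕ (suc N) + q) * f′)
        ≤⟨ p+nonPos≤p (S N) (nonPos*nonNeg qᴺ≤0 0≤tail) ⟩
      S N ∎
      where
      open ≤-Reasoning
      f′ = fact⁻¹ (suc N)
      0≤tail : 0ℚᵘ ≤ (fromℕ (suc N) + q) * f′
      0≤tail = *-nonNeg (-3≤q⇒0≤n+q (s≤s 2≤N) -3≤q) (fact⁻¹-nonNeg (suc N))

    -- Every partial sum from the 7th on stays below the 7th: each step either adds a
    -- nonpositive term, or a pair of terms whose first one is nonpositive and dominant.
    expPartial-≤-7 : ∀ m → S (7 ℕ.+ m) ≤ S 7 × S (8 ℕ.+ m) ≤ S 7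
    expPartial-≤-7 zero    = ≤-refl , expPartial-suc-≤ 7 q⁷≤0
      where
      q⁷≤0 : pow q 7 ≤ 0ℚᵘ
      q⁷≤0 = ≤-respˡ-≃ (≃-sym (solve 1 (λ q → q :^ 7 := q :* ((q :* q) :* ((q :* q) :* (q :* q)))) ≃-refl q))
        (nonPos*nonNeg q≤0 (*-nonNeg (square-nonNeg q) (*-nonNeg (square-nonNeg q) (square-nonNeg q))))
    expPartial-≤-7 (suc m) = S₈₊ₘ≤ , [ pair-step , single-step ]′ (≤-total (pow q (7 ℕ.+ m)) 0ℚᵘ)
      where
      S₇₊ₘ≤ = proj₁ (expPartial-≤-7 m)
      S₈₊ₘ≤ = proj₂ (expPartial-≤-7 m)
      pair-step : pow q (7 ℕ.+ m) ≤ 0ℚᵘ → S (9 ℕ.+ m) ≤ S 7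
      pair-step qᴺ≤0 = ≤-trans (expPartial-suc-suc-≤ (7 ℕ.+ m) (s≤s (s≤s z≤n)) qᴺ≤0) S₇₊ₘ≤
      single-step : 0ℚᵘ ≤ pow q (7 ℕ.+ m) → S (9 ℕ.+ m) ≤ S 7
      single-step 0≤qᴺ = ≤-trans (expPartial-suc-≤ (8 ℕ.+ m) (nonPos*nonNeg q≤0 0≤qᴺ)) S₈₊ₘ≤

    expPartial-nonPos : ∀ N → 7 ℕ.≤ N → S N ≤ 1ℚᵘ + frac (+ 4) 19 * q
    expPartial-nonPos N 7≤N = ≤-trans (subst (λ n → S n ≤ S 7) (ℕ.m+[n∸m]≡n 7≤N) (proj₁ (expPartial-≤-7 (N ℕ.∸ 7))))
      (expPartial-7-≤ -3≤q q≤0)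


  <log-suc : ∀ k {q} → - fromℕ 3 ≤ q → q ≤ harmonic k - 1ℚᵘ → q <log suc k
  <log-suc k {q} -3≤q q≤H-1 with ≤-total q 0ℚᵘ
  <log-suc zero    {q} -3≤q q≤-1 | inj₁ q≤0 = κ , *<* (+<+ (s≤s z≤n)) , 7 , λ N 7≤N → begin
    expPartial q N + κ          ≤⟨ +-monoˡ-≤ κ (expPartial-nonPos -3≤q q≤0 N 7≤N) ⟩
    1ℚᵘ + κ * q + κ             ≤⟨ +-monoˡ-≤ κ (+-monoʳ-≤ 1ℚᵘ (*-monoʳ-≤-0≤ κ (frac-nonNeg 4 19) q≤-1)) ⟩
    1ℚᵘ + κ * (0ℚᵘ - 1ℚᵘ) + κ   ≃⟨ solve 1 (λ κ → con 1ℚᵘ :+ κ :* (con 0ℚᵘ :- con 1ℚᵘ) :+ κ := con 1ℚᵘ) ≃-refl κ ⟩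
    fromℕ 1                     ∎
    where
    open ≤-Reasoning
    κ = frac (+ 4) 19
  <log-suc (suc k) {q} -3≤q _     | inj₁ q≤0 = 1ℚᵘ , *<* (+<+ (s≤s z≤n)) , 7 , λ N 7≤N → begin
    expPartial q N + 1ℚᵘ              ≤⟨ +-monoˡ-≤ 1ℚᵘ (expPartial-nonPos -3≤q q≤0 N 7≤N) ⟩
    1ℚᵘ + frac (+ 4) 19 * q + 1ℚᵘ     ≤⟨ +-monoˡ-≤ 1ℚᵘ (p+nonPos≤p 1ℚᵘ (nonNeg*nonPos (frac-nonNeg 4 19) q≤0)) ⟩
    fromℕ 2                           ≤⟨ fromℕ-mono-≤ (s≤s (s≤s z≤n)) ⟩
    fromℕ (2 ℕ.+ k)                   ∎
    where open ≤-Reasoning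
  <log-suc zero    {q} -3≤q q≤-1 | inj₂ 0≤q with ≤-trans 0≤q q≤-1
  ... | *≤* ()
  <log-suc (suc k) {q} -3≤q q≤H-1 | inj₂ 0≤q = 1ℚᵘ , *<* (+<+ (s≤s z≤n)) , 0 , λ N _ → begin
    expPartial q N + 1ℚᵘ                         ≤⟨ +-monoˡ-≤ 1ℚᵘ (expPartial-mono-≤ N 0≤q q≤H-1) ⟩
    expPartial (harmonic (suc k) - 1ℚᵘ) N + 1ℚᵘ  ≤⟨ +-monoˡ-≤ 1ℚᵘ (expPartial-harmonic k N) ⟩
    fromℕ (suc k) + 1ℚᵘ                          ≃⟨ fromℕ-suc (suc k) ⟩
    fromℕ (2 ℕ.+ k)                              ∎
    where open ≤-Reasoning

module Ratio where

  open Counting using (order; nonDerangements)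
  open Recurrence using (order-pos; nonDerangements-pos; nonDerangements-upper; nonDerangements-ratio; nonDerangements-1; order-1)
  open Fractions
  open ExponentialSeries
  open import Data.Nat as ℕ using (ℕ; zero; suc; z≤n; s≤s)
  import Data.Nat.Properties as ℕ
  open import Data.Nat.Tactic.RingSolver using (solve-∀)
  open import Data.Integer as ℤ using (+_)
  import Data.Integer.Properties as ℤ
  open import Data.Rational.Unnormalised
  open import Data.Rational.Unnormalised.Properties
  open import Data.Rational.Unnormalised.Solver using (module +-*-Solver)
  open import Relation.Binary.PropositionalEquality using (_≡_; sym; cong; subst; subst₂)
  open +-*-Solver

  LowerBound-frac : ∀ {d n c b} → 0 ℕ.< c → 0 ℕ.< b →
                    (frac (+ (2 ℕ.* b)) ((d ℕ.∸ 1) ℕ.* c) - fromℕ (n ℕ.+ 4)) <log n → LowerBound d n (frac (+ c) b)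
  LowerBound-frac {d} {n} {suc c} {suc b} _ _ = subst (λ z → (frac z ((d ℕ.∸ 1) ℕ.* suc c) - fromℕ (n ℕ.+ 4)) <log n) (ℤ.pos-* 2 (suc b))

  module _ (D : ℕ) (1≤D : 1 ℕ.≤ D) where

    private
      b c : ℕ → ℕ
      b = order D
      c = nonDerangements D
      0<Dc : ∀ k → 0 ℕ.< D ℕ.* c (suc k)
      0<Dc k = ℕ.*-mono-≤ 1≤D (nonDerangements-pos D k)

    -- ζ n = 2 / ((d - 1) FPP([C_d]^n))
    ζ : ℕ → ℚᵘ
    ζ n = frac (+ (2 ℕ.* b n)) (D ℕ.* c n)

    ζ-lower : ∀ k → fromℕ (suc k ℕ.+ 1) < ζ (suc k)
    ζ-lower k = frac-< (suc k ℕ.+ 1) (2 ℕ.* b (suc k)) (s≤s z≤n) (0<Dc k)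
      (subst₂ ℕ._<_ (reorder D k (c (suc k))) (sym (ℕ.*-identityʳ _)) (nonDerangements-upper D k))
      where
      reorder : ∀ D k c → D ℕ.* (2 ℕ.+ k) ℕ.* c ≡ (suc k ℕ.+ 1) ℕ.* (D ℕ.* c)
      reorder = solve-∀

    ζ-upper : ∀ k → ζ (suc k) ≤ fromℕ (k ℕ.+ 4) + harmonic k
    ζ-upper zero = subst₂ (λ x y → frac (+ (2 ℕ.* y)) (D ℕ.* x) ≤ fromℕ 4) (sym (nonDerangements-1 D)) (sym (order-1 D))
      (frac-≤ (2 ℕ.* suc D) 4 (ℕ.*-mono-≤ 1≤D (s≤s z≤n)) (s≤s z≤n) (base D 1≤D))
      where
      base : ∀ D → 1 ℕ.≤ D → 2 ℕ.* suc D ℕ.* 1 ℕ.≤ 4 ℕ.* (D ℕ.* 1)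
      base (suc D) _ = subst₂ ℕ._≤_ (lhs D) (rhs D) (ℕ.+-monoʳ-≤ 4 (ℕ.*-monoˡ-≤ D {2} {4} (s≤s (s≤s z≤n))))
        where
        lhs : ∀ D → 4 ℕ.+ 2 ℕ.* D ≡ 2 ℕ.* (2 ℕ.+ D) ℕ.* 1
        lhs = solve-∀
        rhs : ∀ D → 4 ℕ.+ 4 ℕ.* D ≡ 4 ℕ.* ((1 ℕ.+ D) ℕ.* 1)
        rhs = solve-∀
    ζ-upper (suc k) = begin
      ζ (2 ℕ.+ k)
        ≤⟨ frac-≤ (2 ℕ.* b (2 ℕ.+ k)) (2 ℕ.* b n ℕ.* n ℕ.+ (2 ℕ.+ k) ℕ.* (D ℕ.* c n)) (0<Dc (suc k)) (ℕ.*-mono-≤ (0<Dc k) (s≤s z≤n))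
             (nonDerangements-ratio D k) ⟩
      frac (+ (2 ℕ.* b n ℕ.* n ℕ.+ (2 ℕ.+ k) ℕ.* (D ℕ.* c n))) (D ℕ.* c n ℕ.* n)
        ≡⟨ frac-+ (2 ℕ.* b n) (2 ℕ.+ k) (0<Dc k) (s≤s z≤n) ⟨
      ζ n + frac (+ (2 ℕ.+ k)) n
        ≤⟨ +-monoˡ-≤ (frac (+ (2 ℕ.+ k)) n) (ζ-upper k) ⟩
      (fromℕ (k ℕ.+ 4) + harmonic k) + frac (+ (2 ℕ.+ k)) n
        ≃⟨ +-congʳ (fromℕ (k ℕ.+ 4) + harmonic k) (≃-sym 1+1/n) ⟩
      (fromℕ (k ℕ.+ 4) + harmonic k) + (1ℚᵘ + frac (+ 1) n)
        ≃⟨ solve 4 (λ X H o f → (X :+ H) :+ (o :+ f) := (X :+ o) :+ (H :+ f)) ≃-refl (fromℕ (k ℕ.+ 4)) (harmonic k) 1ℚᵘ (frac (+ 1) n) ⟩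
      (fromℕ (k ℕ.+ 4) + 1ℚᵘ) + harmonic n
        ≃⟨ +-congˡ (harmonic n) (fromℕ-suc (k ℕ.+ 4)) ⟩
      fromℕ (n ℕ.+ 4) + harmonic n ∎
      where
      open ≤-Reasoning
      n = suc k
      1+1/n : 1ℚᵘ + frac (+ 1) n ≃ frac (+ (2 ℕ.+ k)) n
      1+1/n = ≃-trans (≃-reflexive (frac-+ 1 {1} 1 {n} (s≤s z≤n) (s≤s z≤n)))
        (frac-≃ (1 ℕ.* n ℕ.+ 1 ℕ.* 1) (2 ℕ.+ k) (s≤s z≤n) (s≤s z≤n) (identity k))
        where
        identity : ∀ k → (1 ℕ.* suc k ℕ.+ 1 ℕ.* 1) ℕ.* suc k ≡ (2 ℕ.+ k) ℕ.* (1 ℕ.* suc k)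
        identity = solve-∀

    ζ-shifted-<log : ∀ k → (ζ (suc k) - fromℕ (suc k ℕ.+ 4)) <log suc k
    ζ-shifted-<log k = <log-suc k -3≤ζ-X ζ-X≤H-1
      where
      X = fromℕ (suc k ℕ.+ 4)
      A = fromℕ (suc k ℕ.+ 1)
      A+3≃X : A + fromℕ 3 ≃ X
      A+3≃X = ≃-trans (fromℕ-+ (suc k ℕ.+ 1) 3) (≃-reflexive (cong fromℕ (ℕ.+-assoc (suc k) 1 3)))
      -3≤ζ-X : - fromℕ 3 ≤ ζ (suc k) - X
      -3≤ζ-X = ≤-trans (≤-reflexive (≃-trans (solve 2 (λ A t → :- t := A :- (A :+ t)) ≃-refl A (fromℕ 3)) (+-congʳ A (-‿cong A+3≃X))))
                       (+-monoˡ-≤ (- X) (<⇒≤ (ζ-lower k)))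
      ζ-X≤H-1 : ζ (suc k) - X ≤ harmonic k - 1ℚᵘ
      ζ-X≤H-1 = ≤-respʳ-≃ (≃-trans (+-congʳ (fromℕ (k ℕ.+ 4) + harmonic k) (-‿cong (≃-sym (fromℕ-suc (k ℕ.+ 4)))))
                                    (solve 2 (λ F H → (F :+ H) :- (F :+ con 1ℚᵘ) := H :- con 1ℚᵘ) ≃-refl (fromℕ (k ℕ.+ 4)) (harmonic k)))
                          (+-monoˡ-≤ (- X) (ζ-upper k))

    fpp-lower : ∀ k → LowerBound (suc D) (suc k) (frac (+ c (suc k)) (b (suc k)))
    fpp-lower k = LowerBound-frac (nonDerangements-pos D k) (order-pos D k) (ζ-shifted-<log k)

    fpp-upper : ∀ k → UpperBound (suc D) (suc k) (frac (+ c (suc k)) (b (suc k)))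
    fpp-upper k = frac-< (c (suc k)) 2 (order-pos D k) (ℕ.*-mono-≤ 1≤D (s≤s z≤n))
      (subst (ℕ._< 2 ℕ.* b (suc k)) (reorder D k (c (suc k))) (nonDerangements-upper D k))
      where
      reorder : ∀ D k c → D ℕ.* (2 ℕ.+ k) ℕ.* c ≡ c ℕ.* (D ℕ.* (suc k ℕ.+ 1))
      reorder = solve-∀

open Counting using (nonDerangements; length-allElems)
open Ratio using (fpp-lower; fpp-upper)
open import Data.Nat using (ℕ; suc; _≤_; s≤s)
open import Data.Integer using (+_)
open import Data.Product using (_×_; _,_)
open import Relation.Binary.PropositionalEquality using (sym; subst)

proposition3p5 : ∀ (d n : ℕ) → 2 ≤ d → 1 ≤ n →
    LowerBound d n (FPP d n) × UpperBound d n (FPP d n)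
proposition3p5 (suc D) (suc k) (s≤s 1≤D) _ =
  subst (λ b → LowerBound (suc D) (suc k) (frac (+ c) b) × UpperBound (suc D) (suc k) (frac (+ c) b))
        (sym (length-allElems D (suc k)))
        (fpp-lower D 1≤D k , fpp-upper D 1≤D k)
  where c = nonDerangements D (suc k)
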